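{- Let $\mathscr{A}$ be a finite set and let $S \subset \mathcal{F}_\mathscr{A}$ be product-free. Then for any sequence of positive integers $\ell_1 < \ell_2 < \dots < \ell_k < n$, we have \begin{align*} & d(\ell_1)d(n-\ell_1) + d(\ell_2;\ell_1)d(n-\ell_2) + \dots + d(\ell_k; \ell_1,\dots,\ell_{k-1})d(n-\ell_k) + d(n) \\ \le\ & d(\ell_1) + d(\ell_2;\ell_1) + \dots + d(\ell_k; \ell_1,\dots,\ell_{k-1}) + d(n; \ell_1, \dots, \ell_k) \le 1. \end{align*}
   Context: $\mathcal{F}_\mathscr{A}$ is the free semigroup over $\mathscr{A}$: all finite nonempty words over $\mathscr{A}$ with concatenation $\cdot$. $S$ is product-free if there are no $x,y,z\in S$ (not necessarily distinct) with $x\cdot y = z$. A word $x$ is a prefix of $w$ if $w = x \cdot y$ for some word $y$. $\mathcal{F}(n)$ is the set of words of length $n$, and $S(n) = S \cap \mathcal{F}(n)$. For positive integers $\ell_1 < \dots < \ell_j < m$, $S(m;\ell_1,\dots,\ell_j)$ is the set of words in $S(m)$ having no prefix in $S(\ell_1)\cup\dots\cup S(\ell_j)$. Write $d(m) = |S(m)|/|\mathcal{F}(m)|$ and $d(m;\ell_1,\dots,\ell_j) = |S(m;\ell_1,\dots,\ell_j)|/|\mathcal{F}(m)|$. -}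

module Defs where

open import Data.Bool using (Bool; true; false; T; not; _∧_)
open import Data.Nat using (ℕ; zero; suc; _^_; _∸_)
open import Data.Nat.Properties using (m^n≢0)
open import Data.Fin using (Fin)
open import Data.List using (List; []; _∷_; _++_; [_]; map; concatMap; allFin; take; length; filterᵇ)
open import Data.Integer using (+_)
open import Data.Rational using (ℚ; _/_; _+_; _*_; 0ℚ)
open import Data.Empty using (⊥)
open import Relation.Binary.PropositionalEquality using (_≡_)

-- Alphabet: 𝒜 = Fin (suc a), a nonempty finite set.
-- Words over 𝒜 are lists; the free semigroup F_𝒜 consists of the NONEMPTY ones.
Word : ℕ → Set
Word a = List (Fin (suc a))

words : (a m : ℕ) → List (Word a)
words a zero    = [ [] ]
words a (suc m) = concatMap (λ w → map (λ c → c ∷ w) (allFin (suc a))) (words a m)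

-- A set S ⊆ F_𝒜 given by its (decidable) characteristic function.
-- Its value on the empty word is irrelevant (the empty word is not in F_𝒜).
Subset : ℕ → Set
Subset a = Word a → Bool

ProductFree : {a : ℕ} → Subset a → Set
ProductFree {a} S = (x y : Word a) → x ≢[] → y ≢[] → T (S x) → T (S y) → T (S (x ++ y)) → ⊥
  where
  _≢[] : Word a → Set
  w ≢[] = w ≡ [] → ⊥

allᵇ : {A : Set} → (A → Bool) → List A → Bool
allᵇ p []       = true
allᵇ p (x ∷ xs) = p x ∧ allᵇ p xs

-- w has a prefix in S(ℓ), i.e. the length-ℓ prefix of w lies in S
-- (used only for ℓ < length w).
hasPrefixIn : {a : ℕ} → Subset a → Word a → ℕ → Bool
hasPrefixIn S w ℓ = S (take ℓ w)

countPre : {a : ℕ} → Subset a → ℕ → List ℕ → ℕ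
countPre {a} S m ls =
  length (filterᵇ (λ w → S w ∧ allᵇ (λ ℓ → not (hasPrefixIn S w ℓ)) ls) (words a m))

-- d(m; ℓ₁,…,ℓⱼ) = |S(m; ℓ₁,…,ℓⱼ)| / |F(m)|,  with |F(m)| = (suc a)^m.
dPre : {a : ℕ} → Subset a → ℕ → List ℕ → ℚ
dPre {a} S m ls = _/_ (+ countPre S m ls) (suc a ^ m) {{m^n≢0 (suc a) m}}

d : {a : ℕ} → Subset a → ℕ → ℚ
d S m = dPre S m []

-- For ls = ℓ₁,…,ℓ_k (and prev = ℓ's already passed):
-- Σᵢ f ℓᵢ (ℓ₁,…,ℓ_{i-1})
sumPre : (ℕ → List ℕ → ℚ) → List ℕ → List ℕ → ℚ
sumPre f prev []       = 0ℚ
sumPre f prev (l ∷ ls) = f l prev + sumPre f (prev ++ [ l ]) ls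

lhsSum : {a : ℕ} → Subset a → ℕ → List ℕ → ℚ
lhsSum S n ls = sumPre (λ l prev → dPre S l prev * d S (n ∸ l)) [] ls

midSum : {a : ℕ} → Subset a → List ℕ → ℚ
midSum S ls = sumPre (λ l prev → dPre S l prev) [] ls

module Submission where

-- Multiply everything by |F(n)|.  For a word w of length n, the events "the ℓᵢ-prefix of w lies
-- in S(ℓᵢ; ℓ₁,…,ℓᵢ₋₁)" (i = 1,…,k) and "w has no prefix in S(ℓ₁) ∪ … ∪ S(ℓₖ)" partition the
-- possibilities, and the i-th one holds for exactly |S(ℓᵢ; ℓ₁,…,ℓᵢ₋₁)|·|F(n − ℓᵢ)| words; this
-- gives the upper bound |F(n)|.  The term |S(ℓᵢ; …)|·|S(n − ℓᵢ)| counts the words of the i-th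
-- event whose suffix of length n − ℓᵢ lies in S; by product-freeness no such word lies in S, so
-- word by word the left-hand side is bounded by the middle.

module Counting where
  open import Defs
  open import Data.Bool using (Bool; true; false; T; not; _∧_)
  open import Data.Bool.Properties using (∧-assoc; ∧-identityʳ)
  open import Data.Empty using (⊥; ⊥-elim)
  open import Data.Nat using (ℕ; zero; suc; _+_; _*_; _^_; _∸_; _≤_; _<_; z≤n; s≤s)
  open import Data.Nat.Properties
  open import Algebra.Properties.CommutativeSemigroup +-commutativeSemigroup using (interchange)
  open import Data.Nat.ListAction using (sum)
  open import Data.List using (List; []; _∷_; _++_; [_]; map; concatMap; allFin; take; drop; length; filterᵇ)
  open import Data.List.Properties
    using (map-cong; map-cong-local; ++-assoc; ++-identityʳ; length-tabulate; take-take; take++drop≡id)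
  open import Data.List.Relation.Unary.All as All using (All; []; _∷_)
  open import Data.List.Relation.Unary.All.Properties using (map⁺; concat⁺; tabulate⁺; ++⁺)
  open import Data.List.Relation.Unary.AllPairs using (AllPairs; []; _∷_)
  open import Data.Product using (_,_)
  open import Relation.Binary.PropositionalEquality hiding ([_])
  open ≡-Reasoning

  ind : Bool → ℕ
  ind true  = 1
  ind false = 0

  ∑ : {A : Set} → List A → (A → ℕ) → ℕ
  ∑ xs f = sum (map f xs)

  module _ {A : Set} where

    ∑-cong : (xs : List A) {f g : A → ℕ} → (∀ x → f x ≡ g x) → ∑ xs f ≡ ∑ xs g
    ∑-cong xs f≗g = cong sum (map-cong f≗g xs)

    ∑-cong-local : {xs : List A} {f g : A → ℕ} → All (λ x → f x ≡ g x) xs → ∑ xs f ≡ ∑ xs g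
    ∑-cong-local eqs = cong sum (map-cong-local eqs)

    ∑-mono-local : {xs : List A} {f g : A → ℕ} → All (λ x → f x ≤ g x) xs → ∑ xs f ≤ ∑ xs g
    ∑-mono-local []             = z≤n
    ∑-mono-local (fx≤gx ∷ ineqs) = +-mono-≤ fx≤gx (∑-mono-local ineqs)

    ∑-++ : (xs ys : List A) (f : A → ℕ) → ∑ (xs ++ ys) f ≡ ∑ xs f + ∑ ys f
    ∑-++ []       ys f = refl
    ∑-++ (x ∷ xs) ys f = trans (cong (f x +_) (∑-++ xs ys f)) (sym (+-assoc (f x) _ _))

    ∑-+ : (xs : List A) (f g : A → ℕ) → ∑ xs (λ x → f x + g x) ≡ ∑ xs f + ∑ xs g
    ∑-+ []       f g = refl
    ∑-+ (x ∷ xs) f g = trans (cong ((f x + g x) +_) (∑-+ xs f g)) (interchange (f x) (g x) (∑ xs f) (∑ xs g))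

    ∑-*ʳ : (xs : List A) (f : A → ℕ) (c : ℕ) → ∑ xs (λ x → f x * c) ≡ ∑ xs f * c
    ∑-*ʳ []       f c = refl
    ∑-*ʳ (x ∷ xs) f c = trans (cong (f x * c +_) (∑-*ʳ xs f c)) (sym (*-distribʳ-+ c (f x) (∑ xs f)))

    ∑-*ˡ : (xs : List A) (f : A → ℕ) (c : ℕ) → ∑ xs (λ x → c * f x) ≡ c * ∑ xs f
    ∑-*ˡ xs f c = trans (∑-cong xs (λ x → *-comm c (f x))) (trans (∑-*ʳ xs f c) (*-comm (∑ xs f) c))

    ∑-const : (xs : List A) (c : ℕ) → ∑ xs (λ _ → c) ≡ length xs * c
    ∑-const []       c = refl
    ∑-const (x ∷ xs) c = cong (c +_) (∑-const xs c)

    length-filterᵇ : (p : A → Bool) (xs : List A) → length (filterᵇ p xs) ≡ ∑ xs (λ x → ind (p x))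
    length-filterᵇ p []       = refl
    length-filterᵇ p (x ∷ xs) with p x
    ... | true  = cong suc (length-filterᵇ p xs)
    ... | false = length-filterᵇ p xs

  ∑-swap : {A B : Set} (xs : List A) (ys : List B) (f : A → B → ℕ) →
    ∑ xs (λ x → ∑ ys (f x)) ≡ ∑ ys (λ y → ∑ xs (λ x → f x y))
  ∑-swap []       ys f = sym (trans (∑-const ys 0) (*-zeroʳ (length ys)))
  ∑-swap (x ∷ xs) ys f =
    trans (cong (∑ ys (f x) +_) (∑-swap xs ys f)) (sym (∑-+ ys (f x) (λ y → ∑ xs (λ x′ → f x′ y))))

  ∑-concatMap : {A B : Set} (g : A → List B) (xs : List A) (f : B → ℕ) →
    ∑ (concatMap g xs) f ≡ ∑ xs (λ x → ∑ (g x) f)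
  ∑-concatMap g []       f = refl
  ∑-concatMap g (x ∷ xs) f = trans (∑-++ (g x) (concatMap g xs) f) (cong (∑ (g x) f +_) (∑-concatMap g xs f))

  ∑-map : {A B : Set} (g : A → B) (xs : List A) (f : B → ℕ) → ∑ (map g xs) f ≡ ∑ xs (λ x → f (g x))
  ∑-map g []       f = refl
  ∑-map g (x ∷ xs) f = cong (f (g x) +_) (∑-map g xs f)

  sumPreℕ : (ℕ → List ℕ → ℕ) → List ℕ → List ℕ → ℕ
  sumPreℕ f prev []       = 0
  sumPreℕ f prev (l ∷ ls) = f l prev + sumPreℕ f (prev ++ [ l ]) ls

  ∑-sumPreℕ : {A : Set} (xs : List A) (g : ℕ → List ℕ → A → ℕ) (prev ls : List ℕ) →
    ∑ xs (λ x → sumPreℕ (λ l pr → g l pr x) prev ls) ≡ sumPreℕ (λ l pr → ∑ xs (g l pr)) prev ls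
  ∑-sumPreℕ xs g prev []       = trans (∑-const xs 0) (*-zeroʳ (length xs))
  ∑-sumPreℕ xs g prev (l ∷ ls) =
    trans (∑-+ xs (g l prev) (λ x → sumPreℕ (λ l pr → g l pr x) (prev ++ [ l ]) ls))
          (cong (∑ xs (g l prev) +_) (∑-sumPreℕ xs g (prev ++ [ l ]) ls))

  sumPreℕ-cong-local : {P : ℕ → Set} {f g : ℕ → List ℕ → ℕ} (prev : List ℕ) {ls : List ℕ} → All P ls →
    (∀ {l} pr → P l → f l pr ≡ g l pr) → sumPreℕ f prev ls ≡ sumPreℕ g prev ls
  sumPreℕ-cong-local prev []         f≡g = refl
  sumPreℕ-cong-local prev {l ∷ _} (pl ∷ pls) f≡g =
    cong₂ _+_ (f≡g prev pl) (sumPreℕ-cong-local (prev ++ [ l ]) pls f≡g)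

  sumPreℕ-mono : {f g : ℕ → List ℕ → ℕ} (prev ls : List ℕ) →
    (∀ l pr → f l pr ≤ g l pr) → sumPreℕ f prev ls ≤ sumPreℕ g prev ls
  sumPreℕ-mono prev []       f≤g = z≤n
  sumPreℕ-mono prev (l ∷ ls) f≤g = +-mono-≤ (f≤g l prev) (sumPreℕ-mono (prev ++ [ l ]) ls f≤g)

  sumPreℕ-≡0 : {P : ℕ → Set} {f : ℕ → List ℕ → ℕ} (prev : List ℕ) {ls : List ℕ} → All P ls →
    (∀ {l} pr → P l → f l pr ≡ 0) → sumPreℕ f prev ls ≡ 0
  sumPreℕ-≡0 prev []                 f≡0 = refl
  sumPreℕ-≡0 prev {l ∷ _} (pl ∷ pls) f≡0 rewrite f≡0 prev pl = sumPreℕ-≡0 (prev ++ [ l ]) pls f≡0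

  module _ {A : Set} where

    take-length-++ : (u v : List A) → take (length u) (u ++ v) ≡ u
    take-length-++ []      v = refl
    take-length-++ (x ∷ u) v = cong (x ∷_) (take-length-++ u v)

    drop-length-++ : (u v : List A) → drop (length u) (u ++ v) ≡ v
    drop-length-++ []      v = refl
    drop-length-++ (x ∷ u) v = drop-length-++ u v

    take≢[] : ∀ l (w : List A) → 0 < l → l < length w → take l w ≢ []
    take≢[] (suc l) (x ∷ w) _ _ ()

    drop≢[] : ∀ l (w : List A) → l < length w → drop l w ≢ []
    drop≢[] zero    (x ∷ w) _          ()
    drop≢[] (suc l) (x ∷ w) (s≤s l<|w|) = drop≢[] l w l<|w|

    allᵇ-++ : (p : A → Bool) (xs ys : List A) → allᵇ p (xs ++ ys) ≡ allᵇ p xs ∧ allᵇ p ys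
    allᵇ-++ p []       ys = refl
    allᵇ-++ p (x ∷ xs) ys = trans (cong (p x ∧_) (allᵇ-++ p xs ys)) (sym (∧-assoc (p x) _ _))

    allᵇ-cong-local : {P : A → Set} {p q : A → Bool} {xs : List A} → All P xs →
      (∀ {x} → P x → p x ≡ q x) → allᵇ p xs ≡ allᵇ q xs
    allᵇ-cong-local []         p≡q = refl
    allᵇ-cong-local (px ∷ pxs) p≡q = cong₂ _∧_ (p≡q px) (allᵇ-cong-local pxs p≡q)

  ind-∧-≤ʳ : (x y : Bool) → ind (x ∧ y) ≤ ind y
  ind-∧-≤ʳ true  y = ≤-refl
  ind-∧-≤ʳ false y = z≤n

  ind-*-≤ˡ : (x y : Bool) → ind x * ind y ≤ ind x
  ind-*-≤ˡ true  true  = ≤-refl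
  ind-*-≤ˡ true  false = z≤n
  ind-*-≤ˡ false y     = z≤n

  ind-∧-split : (x y : Bool) → ind (x ∧ y) + ind (y ∧ (not x ∧ true)) ≡ ind y
  ind-∧-split true  true  = refl
  ind-∧-split true  false = refl
  ind-∧-split false true  = refl
  ind-∧-split false false = refl

  ind-∧-*-≡0 : (x y z : Bool) → (T x → T z → ⊥) → ind (x ∧ y) * ind z ≡ 0
  ind-∧-*-≡0 true  y true  ¬x∧z = ⊥-elim (¬x∧z _ _)
  ind-∧-*-≡0 true  y false ¬x∧z = *-zeroʳ (ind y)
  ind-∧-*-≡0 false y z     ¬x∧z = refl

  module Words (a : ℕ) where

    N : ℕ
    N = suc a

    words-length : (m : ℕ) → All (λ w → length w ≡ m) (words a m)
    words-length zero    = refl ∷ []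
    words-length (suc m) =
      concat⁺ (map⁺ (All.map (λ |w|≡m → map⁺ (tabulate⁺ {f = λ c → c} (λ _ → cong suc |w|≡m))) (words-length m)))

    ∑-words-suc : (m : ℕ) (f : Word a → ℕ) →
      ∑ (words a (suc m)) f ≡ ∑ (words a m) (λ w → ∑ (allFin N) (λ c → f (c ∷ w)))
    ∑-words-suc m f = trans (∑-concatMap _ (words a m) f) (∑-cong (words a m) (λ w → ∑-map (_∷ w) (allFin N) f))

    ∑-words-1 : (m : ℕ) → ∑ (words a m) (λ _ → 1) ≡ N ^ m
    ∑-words-1 zero    = refl
    ∑-words-1 (suc m) = begin
      ∑ (words a (suc m)) (λ _ → 1)                    ≡⟨ ∑-words-suc m _ ⟩
      ∑ (words a m) (λ _ → ∑ (allFin N) (λ _ → 1))     ≡⟨ ∑-cong (words a m) (λ _ → ∑-allFin-1) ⟩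
      ∑ (words a m) (λ _ → N)                          ≡⟨ ∑-cong (words a m) (λ _ → sym (*-identityˡ N)) ⟩
      ∑ (words a m) (λ _ → 1 * N)                      ≡⟨ ∑-*ʳ (words a m) (λ _ → 1) N ⟩
      ∑ (words a m) (λ _ → 1) * N                      ≡⟨ cong (_* N) (∑-words-1 m) ⟩
      N ^ m * N                                        ≡⟨ *-comm (N ^ m) N ⟩
      N ^ suc m                                        ∎
      where
      ∑-allFin-1 : ∑ (allFin N) (λ _ → 1) ≡ N
      ∑-allFin-1 = trans (∑-const (allFin N) 1) (trans (*-identityʳ _) (length-tabulate {n = N} (λ i → i)))

    ∑-words-++ : (l k : ℕ) (f : Word a → ℕ) →
      ∑ (words a (l + k)) f ≡ ∑ (words a l) (λ u → ∑ (words a k) (λ v → f (u ++ v)))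
    ∑-words-++ zero    k f = sym (+-identityʳ _)
    ∑-words-++ (suc l) k f = begin
      ∑ (words a (suc (l + k))) f                                  ≡⟨ ∑-words-suc (l + k) f ⟩
      ∑ (words a (l + k)) (λ w → ∑ (allFin N) (λ c → f (c ∷ w)))   ≡⟨ ∑-words-++ l k _ ⟩
      ∑ (words a l) (λ u → ∑ (words a k) (λ v → ∑ (allFin N) (λ c → f (c ∷ u ++ v))))
        ≡⟨ ∑-cong (words a l) (λ u → ∑-swap (words a k) (allFin N) (λ v c → f (c ∷ u ++ v))) ⟩
      ∑ (words a l) (λ u → ∑ (allFin N) (λ c → ∑ (words a k) (λ v → f (c ∷ u ++ v))))
        ≡⟨ ∑-words-suc l _ ⟨
      ∑ (words a (suc l)) (λ u → ∑ (words a k) (λ v → f (u ++ v)))  ∎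

    ∑-words-take-drop : {l n : ℕ} (f g : Word a → ℕ) → l ≤ n →
      ∑ (words a n) (λ w → f (take l w) * g (drop l w)) ≡ ∑ (words a l) f * ∑ (words a (n ∸ l)) g
    ∑-words-take-drop {l} {n} f g l≤n = begin
      ∑ (words a n) h                                            ≡⟨ cong (λ m → ∑ (words a m) h) (m+[n∸m]≡n l≤n) ⟨
      ∑ (words a (l + k)) h                                      ≡⟨ ∑-words-++ l k h ⟩
      ∑ (words a l) (λ u → ∑ (words a k) (λ v → h (u ++ v)))
        ≡⟨ ∑-cong-local (All.map split-at-u (words-length l)) ⟩
      ∑ (words a l) (λ u → ∑ (words a k) (λ v → f u * g v))
        ≡⟨ ∑-cong (words a l) (λ u → ∑-*ˡ (words a k) g (f u)) ⟩
      ∑ (words a l) (λ u → f u * ∑ (words a k) g)                 ≡⟨ ∑-*ʳ (words a l) f _ ⟩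
      ∑ (words a l) f * ∑ (words a k) g                          ∎
      where
      k = n ∸ l
      h : Word a → ℕ
      h w = f (take l w) * g (drop l w)
      split-at-u : {u : Word a} → length u ≡ l →
        ∑ (words a k) (λ v → h (u ++ v)) ≡ ∑ (words a k) (λ v → f u * g v)
      split-at-u {u} refl =
        ∑-cong (words a k) (λ v → cong₂ (λ x y → f x * g y) (take-length-++ u v) (drop-length-++ u v))

  module Prefixes {a : ℕ} (S : Subset a) where

    avoids : List ℕ → Word a → Bool
    avoids ℓs w = allᵇ (λ ℓ → not (hasPrefixIn S w ℓ)) ℓs

    inSPre : List ℕ → Word a → Bool
    inSPre ℓs w = S w ∧ avoids ℓs w

    hit : List ℕ → ℕ → Word a → ℕ
    hit pr l w = ind (inSPre pr (take l w))

    hits : List ℕ → List ℕ → Word a → ℕ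
    hits prev ls w = sumPreℕ (λ l pr → hit pr l w) prev ls

    splits : List ℕ → List ℕ → Word a → ℕ
    splits prev ls w = sumPreℕ (λ l pr → hit pr l w * ind (S (drop l w))) prev ls

    avoids-take : {l : ℕ} (pr : List ℕ) (w : Word a) → All (_≤ l) pr → avoids pr (take l w) ≡ avoids pr w
    avoids-take {l} pr w pr≤l = allᵇ-cong-local pr≤l (λ {ℓ} ℓ≤l → cong (λ u → not (S u))
      (trans (take-take ℓ l w) (cong (λ m → take m w) (m≤n⇒m⊓n≡m ℓ≤l))))

    hits-partition : (prev ls : List ℕ) (w : Word a) → AllPairs _<_ ls → All (λ p → All (p <_) ls) prev →
      hits prev ls w + ind (avoids (prev ++ ls) w) ≡ ind (avoids prev w)
    hits-partition prev []       w _                prev<ls = cong (λ ℓs → ind (avoids ℓs w)) (++-identityʳ prev)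
    hits-partition prev (l ∷ ls) w (l<ls ∷ sorted) prev<ls = begin
      (hit prev l w + hits prev′ ls w) + ind (avoids (prev ++ l ∷ ls) w)
        ≡⟨ cong (λ ℓs → (hit prev l w + hits prev′ ls w) + ind (avoids ℓs w)) (++-assoc prev [ l ] ls) ⟨
      (hit prev l w + hits prev′ ls w) + ind (avoids (prev′ ++ ls) w)
        ≡⟨ +-assoc (hit prev l w) _ _ ⟩
      hit prev l w + (hits prev′ ls w + ind (avoids (prev′ ++ ls) w))
        ≡⟨ cong (hit prev l w +_) (hits-partition prev′ ls w sorted prev′<ls) ⟩
      hit prev l w + ind (avoids prev′ w)
        ≡⟨ cong₂ (λ x y → ind (S (take l w) ∧ x) + ind y) (avoids-take prev w prev≤l) (allᵇ-++ _ prev [ l ]) ⟩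
      ind (S (take l w) ∧ avoids prev w) + ind (avoids prev w ∧ (not (S (take l w)) ∧ true))
        ≡⟨ ind-∧-split (S (take l w)) (avoids prev w) ⟩
      ind (avoids prev w) ∎
      where
      prev′ = prev ++ [ l ]
      prev≤l : All (_≤ l) prev
      prev≤l = All.map (λ p<l∷ls → <⇒≤ (All.head p<l∷ls)) prev<ls
      prev′<ls : All (λ p → All (p <_) ls) prev′
      prev′<ls = ++⁺ (All.map All.tail prev<ls) (l<ls ∷ [])

    module _ (productFree : ProductFree S) where

      ¬S-take∧S-drop : {l : ℕ} (w : Word a) → 0 < l → l < length w → T (S w) →
        T (S (take l w)) → T (S (drop l w)) → ⊥
      ¬S-take∧S-drop {l} w 0<l l<|w| Sw Su Sv = productFree (take l w) (drop l w)
        (take≢[] l w 0<l l<|w|) (drop≢[] l w l<|w|) Su Sv (subst (λ x → T (S x)) (sym (take++drop≡id l w)) Sw)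

      splits≡0 : (prev ls : List ℕ) (w : Word a) → T (S w) → All (0 <_) ls → All (_< length w) ls →
        splits prev ls w ≡ 0
      splits≡0 prev ls w Sw pos short = sumPreℕ-≡0 prev (All.zip (pos , short))
        (λ {l} pr (0<l , l<|w|) → ind-∧-*-≡0 (S (take l w)) _ (S (drop l w)) (¬S-take∧S-drop w 0<l l<|w| Sw))

      splits+inSPre≤hits+inSPre : (ls : List ℕ) (w : Word a) →
        AllPairs _<_ ls → All (0 <_) ls → All (_< length w) ls →
        splits [] ls w + ind (inSPre [] w) ≤ hits [] ls w + ind (inSPre ls w)
      splits+inSPre≤hits+inSPre ls w sorted pos short with S w in Sw≡
      ... | true  = ≤-reflexive (begin
        splits [] ls w + 1          ≡⟨ cong (_+ 1) (splits≡0 [] ls w (subst T (sym Sw≡) _) pos short) ⟩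
        1                           ≡⟨ hits-partition [] ls w sorted [] ⟨
        hits [] ls w + ind (avoids ls w) ∎)
      ... | false = +-monoˡ-≤ 0 (sumPreℕ-mono [] ls (λ l pr → ind-*-≤ˡ _ (S (drop l w))))

    hits+inSPre≤1 : (ls : List ℕ) (w : Word a) → AllPairs _<_ ls → hits [] ls w + ind (inSPre ls w) ≤ 1
    hits+inSPre≤1 ls w sorted = ≤-trans (+-monoʳ-≤ (hits [] ls w) (ind-∧-≤ʳ (S w) (avoids ls w)))
                                        (≤-reflexive (hits-partition [] ls w sorted []))

  module Densities {a : ℕ} (S : Subset a) where
    open Words a
    open Prefixes S

    countPre≡∑ : (m : ℕ) (ls : List ℕ) → countPre S m ls ≡ ∑ (words a m) (λ w → ind (inSPre ls w))
    countPre≡∑ m ls = length-filterᵇ _ (words a m)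

    countPre[]≡∑ : (m : ℕ) → countPre S m [] ≡ ∑ (words a m) (λ w → ind (S w))
    countPre[]≡∑ m = trans (countPre≡∑ m []) (∑-cong (words a m) (λ w → cong ind (∧-identityʳ (S w))))

    ∑-hits : {n : ℕ} (prev ls : List ℕ) → All (_≤ n) ls →
      ∑ (words a n) (hits prev ls) ≡ sumPreℕ (λ l pr → countPre S l pr * N ^ (n ∸ l)) prev ls
    ∑-hits {n} prev ls ls≤n = trans (∑-sumPreℕ (words a n) (λ l pr w → hit pr l w) prev ls)
      (sumPreℕ-cong-local prev ls≤n (λ {l} pr l≤n → begin
        ∑ (words a n) (hit pr l)                         ≡⟨ ∑-cong (words a n) (λ w → *-identityʳ (hit pr l w)) ⟨
        ∑ (words a n) (λ w → hit pr l w * 1)             ≡⟨ ∑-words-take-drop _ (λ _ → 1) l≤n ⟩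
        ∑ (words a l) (λ u → ind (inSPre pr u)) * ∑ (words a (n ∸ l)) (λ _ → 1)
                                                         ≡⟨ cong₂ _*_ (countPre≡∑ l pr) (sym (∑-words-1 (n ∸ l))) ⟨
        countPre S l pr * N ^ (n ∸ l)                    ∎))

    ∑-splits : {n : ℕ} (prev ls : List ℕ) → All (_≤ n) ls →
      ∑ (words a n) (splits prev ls) ≡ sumPreℕ (λ l pr → countPre S l pr * countPre S (n ∸ l) []) prev ls
    ∑-splits {n} prev ls ls≤n = trans (∑-sumPreℕ (words a n) (λ l pr w → hit pr l w * ind (S (drop l w))) prev ls)
      (sumPreℕ-cong-local prev ls≤n (λ {l} pr l≤n → begin
        ∑ (words a n) (λ w → hit pr l w * ind (S (drop l w)))  ≡⟨ ∑-words-take-drop _ _ l≤n ⟩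
        ∑ (words a l) (λ u → ind (inSPre pr u)) * ∑ (words a (n ∸ l)) (λ v → ind (S v))
          ≡⟨ cong₂ _*_ (countPre≡∑ l pr) (countPre[]≡∑ (n ∸ l)) ⟨
        countPre S l pr * countPre S (n ∸ l) []                ∎))

    -- |F(n)| times the left-hand side and the middle of the inequality.
    scaledLhs : ℕ → List ℕ → ℕ
    scaledLhs n ls = sumPreℕ (λ l pr → countPre S l pr * countPre S (n ∸ l) []) [] ls + countPre S n []

    scaledMid : ℕ → List ℕ → ℕ
    scaledMid n ls = sumPreℕ (λ l pr → countPre S l pr * N ^ (n ∸ l)) [] ls + countPre S n ls

    scaledLhs≡∑ : (n : ℕ) (ls : List ℕ) → All (_≤ n) ls →
      scaledLhs n ls ≡ ∑ (words a n) (λ w → splits [] ls w + ind (inSPre [] w))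
    scaledLhs≡∑ n ls ls≤n = sym (trans (∑-+ (words a n) (splits [] ls) _)
      (cong₂ _+_ (∑-splits [] ls ls≤n) (sym (countPre≡∑ n []))))

    scaledMid≡∑ : (n : ℕ) (ls : List ℕ) → All (_≤ n) ls →
      scaledMid n ls ≡ ∑ (words a n) (λ w → hits [] ls w + ind (inSPre ls w))
    scaledMid≡∑ n ls ls≤n = sym (trans (∑-+ (words a n) (hits [] ls) _)
      (cong₂ _+_ (∑-hits [] ls ls≤n) (sym (countPre≡∑ n ls))))

    scaledLhs≤scaledMid : ProductFree S → (n : ℕ) (ls : List ℕ) →
      AllPairs _<_ ls → All (0 <_) ls → All (_< n) ls → scaledLhs n ls ≤ scaledMid n ls
    scaledLhs≤scaledMid productFree n ls sorted pos ls<n = subst₂ _≤_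
      (sym (scaledLhs≡∑ n ls ls≤n)) (sym (scaledMid≡∑ n ls ls≤n))
      (∑-mono-local (All.map pointwise (words-length n)))
      where
      ls≤n = All.map <⇒≤ ls<n
      pointwise : {w : Word a} → length w ≡ n → splits [] ls w + ind (inSPre [] w) ≤ hits [] ls w + ind (inSPre ls w)
      pointwise {w} |w|≡n =
        splits+inSPre≤hits+inSPre productFree ls w sorted pos (subst (λ m → All (_< m) ls) (sym |w|≡n) ls<n)

    scaledMid≤N^n : (n : ℕ) (ls : List ℕ) → AllPairs _<_ ls → All (_≤ n) ls → scaledMid n ls ≤ N ^ n
    scaledMid≤N^n n ls sorted ls≤n = subst₂ _≤_ (sym (scaledMid≡∑ n ls ls≤n)) (∑-words-1 n)
      (∑-mono-local (All.universal (λ w → hits+inSPre≤1 ls w sorted) (words a n)))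

module CommonDenominator where
  open import Defs
  open Counting
  open import Data.Nat as ℕ using (ℕ; suc; NonZero; _^_; _∸_)
  open import Data.Nat.Properties as ℕ using (m*n≢0; m^n≢0)
  open import Data.Integer as ℤ using (+_; +≤+)
  open import Data.Integer.Properties using (pos-*; pos-+)
  open import Data.List using (List; []; _∷_; _++_; [_])
  open import Data.List.Relation.Unary.All using (All; []; _∷_)
  open import Data.Rational as ℚ using (ℚ; toℚᵘ; 1ℚ)
  open import Data.Rational.Properties using (toℚᵘ-fromℚᵘ; toℚᵘ-homo-+; toℚᵘ-homo-*; toℚᵘ-cancel-≤)
  open import Data.Rational.Unnormalised as ℚᵘ using (ℚᵘ; mkℚᵘ; *≡*; *≤*; _≃_; _/_)
  open import Data.Rational.Unnormalised.Properties using (≃-sym; ≃-trans; +-cong; *-cong; ≤-respˡ-≃; ≤-respʳ-≃)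
  open import Relation.Binary.PropositionalEquality
    using (_≡_; refl; sym; trans; cong; cong₂; subst₂; module ≡-Reasoning)

  frac : ℕ → (m : ℕ) → .{{NonZero m}} → ℚᵘ
  frac k m = + k / m

  frac-cong : (p q m m′ : ℕ) .{{_ : NonZero m}} .{{_ : NonZero m′}} →
    p ℕ.* m′ ≡ q ℕ.* m → frac p m ≃ frac q m′
  frac-cong p q (suc m) (suc m′) pm′≡qm = *≡* (trans (sym (pos-* p _)) (trans (cong +_ pm′≡qm) (pos-* q _)))

  frac-mono : (p q m m′ : ℕ) .{{_ : NonZero m}} .{{_ : NonZero m′}} →
    p ℕ.* m′ ℕ.≤ q ℕ.* m → frac p m ℚᵘ.≤ frac q m′
  frac-mono p q (suc m) (suc m′) pm′≤qm = *≤* (subst₂ ℤ._≤_ (pos-* p _) (pos-* q _) (+≤+ pm′≤qm))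

  frac-* : (p q m m′ : ℕ) .{{_ : NonZero m}} .{{_ : NonZero m′}} →
    frac p m ℚᵘ.* frac q m′ ≃ frac (p ℕ.* q) (m ℕ.* m′) {{m*n≢0 m m′}}
  frac-* p q (suc m) (suc m′) = *≡* (cong (ℤ._* (+ (suc m ℕ.* suc m′))) (sym (pos-* p q)))

  frac-+ : (p q m : ℕ) .{{_ : NonZero m}} → frac p m ℚᵘ.+ frac q m ≃ frac (p ℕ.+ q) m
  frac-+ p q m@(suc _) = *≡* (begin
    (+ p ℤ.* + m ℤ.+ + q ℤ.* + m) ℤ.* + m   ≡⟨ cong (ℤ._* + m) (cong₂ ℤ._+_ (pos-* p m) (pos-* q m)) ⟨
    (+ (p ℕ.* m) ℤ.+ + (q ℕ.* m)) ℤ.* + m   ≡⟨ cong (ℤ._* + m) (pos-+ (p ℕ.* m) (q ℕ.* m)) ⟨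
    + (p ℕ.* m ℕ.+ q ℕ.* m) ℤ.* + m         ≡⟨ pos-* (p ℕ.* m ℕ.+ q ℕ.* m) m ⟨
    + ((p ℕ.* m ℕ.+ q ℕ.* m) ℕ.* m)         ≡⟨ cong (λ k → + (k ℕ.* m)) (ℕ.*-distribʳ-+ m p q) ⟨
    + ((p ℕ.+ q) ℕ.* m ℕ.* m)               ≡⟨ cong +_ (ℕ.*-assoc (p ℕ.+ q) m m) ⟩
    + ((p ℕ.+ q) ℕ.* (m ℕ.* m))             ≡⟨ pos-* (p ℕ.+ q) (m ℕ.* m) ⟩
    + (p ℕ.+ q) ℤ.* + (m ℕ.* m)             ∎)
    where open ≡-Reasoning

  toℚᵘ-/ : (k m : ℕ) .{{_ : NonZero m}} → toℚᵘ (+ k ℚ./ m) ≃ frac k m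
  toℚᵘ-/ k (suc m) = toℚᵘ-fromℚᵘ (mkℚᵘ (+ k) m)

  toℚᵘ-+-frac : {x y : ℚ} {p q m : ℕ} .{{_ : NonZero m}} →
    toℚᵘ x ≃ frac p m → toℚᵘ y ≃ frac q m → toℚᵘ (x ℚ.+ y) ≃ frac (p ℕ.+ q) m
  toℚᵘ-+-frac {x} {y} {p} {q} {m} x≃p y≃q = ≃-trans (toℚᵘ-homo-+ x y) (≃-trans (+-cong x≃p y≃q) (frac-+ p q m))

  ≤-by-numerators : {x y : ℚ} {p q m : ℕ} .{{_ : NonZero m}} →
    toℚᵘ x ≃ frac p m → toℚᵘ y ≃ frac q m → p ℕ.≤ q → x ℚ.≤ y
  ≤-by-numerators {p = p} {q} {m} x≃p y≃q p≤q =
    toℚᵘ-cancel-≤ (≤-respˡ-≃ (≃-sym x≃p) (≤-respʳ-≃ (≃-sym y≃q) (frac-mono p q m m (ℕ.*-monoˡ-≤ m p≤q))))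

  module OverCommonDenominator {a : ℕ} (S : Subset a) (n : ℕ) where
    open Words a using (N)
    open Densities S

    instance
      N^n-nonZero : NonZero (N ^ n)
      N^n-nonZero = m^n≢0 N n

    N^n-split : {l : ℕ} → l ℕ.≤ n → N ^ n ≡ N ^ l ℕ.* N ^ (n ∸ l)
    N^n-split {l} l≤n = trans (cong (N ^_) (sym (ℕ.m+[n∸m]≡n l≤n))) (ℕ.^-distribˡ-+-* N l (n ∸ l))

    dPre≃ : {l : ℕ} (pr : List ℕ) → l ℕ.≤ n → toℚᵘ (dPre S l pr) ≃ frac (countPre S l pr ℕ.* N ^ (n ∸ l)) (N ^ n)
    dPre≃ {l} pr l≤n = ≃-trans (toℚᵘ-/ c (N ^ l)) (frac-cong c (c ℕ.* N ^ (n ∸ l)) (N ^ l) (N ^ n) (begin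
      c ℕ.* N ^ n                       ≡⟨ cong (c ℕ.*_) (trans (N^n-split l≤n) (ℕ.*-comm (N ^ l) _)) ⟩
      c ℕ.* (N ^ (n ∸ l) ℕ.* N ^ l)     ≡⟨ ℕ.*-assoc c _ _ ⟨
      c ℕ.* N ^ (n ∸ l) ℕ.* N ^ l       ∎))
      where
      open ≡-Reasoning
      c = countPre S l pr
      instance
        N^l-nonZero : NonZero (N ^ l)
        N^l-nonZero = m^n≢0 N l

    dPre*d≃ : {l : ℕ} (pr : List ℕ) → l ℕ.≤ n →
      toℚᵘ (dPre S l pr ℚ.* d S (n ∸ l)) ≃ frac (countPre S l pr ℕ.* countPre S (n ∸ l) []) (N ^ n)
    dPre*d≃ {l} pr l≤n = ≃-trans (toℚᵘ-homo-* (dPre S l pr) (d S (n ∸ l)))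
      (≃-trans (*-cong (toℚᵘ-/ c (N ^ l)) (toℚᵘ-/ c′ (N ^ (n ∸ l))))
      (≃-trans (frac-* c c′ (N ^ l) (N ^ (n ∸ l)))
               (frac-cong (c ℕ.* c′) (c ℕ.* c′) _ (N ^ n) {{m*n≢0 (N ^ l) (N ^ (n ∸ l))}}
                          (cong (c ℕ.* c′ ℕ.*_) (N^n-split l≤n)))))
      where
      c = countPre S l pr
      c′ = countPre S (n ∸ l) []
      instance
        N^l-nonZero : NonZero (N ^ l)
        N^l-nonZero = m^n≢0 N l
        N^[n∸l]-nonZero : NonZero (N ^ (n ∸ l))
        N^[n∸l]-nonZero = m^n≢0 N (n ∸ l)

    sumPre≃ : {f : ℕ → List ℕ → ℚ} {g : ℕ → List ℕ → ℕ} (prev : List ℕ) {ls : List ℕ} → All (ℕ._≤ n) ls →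
      (∀ {l} pr → l ℕ.≤ n → toℚᵘ (f l pr) ≃ frac (g l pr) (N ^ n)) →
      toℚᵘ (sumPre f prev ls) ≃ frac (sumPreℕ g prev ls) (N ^ n)
    sumPre≃ prev []                 f≃g = ≃-trans (toℚᵘ-/ 0 1) (frac-cong 0 0 1 (N ^ n) refl)
    sumPre≃ prev {l ∷ _} (l≤n ∷ ls≤n) f≃g = toℚᵘ-+-frac (f≃g prev l≤n) (sumPre≃ (prev ++ [ l ]) ls≤n f≃g)

    lhs≃ : (ls : List ℕ) → All (ℕ._≤ n) ls → toℚᵘ (lhsSum S n ls ℚ.+ d S n) ≃ frac (scaledLhs n ls) (N ^ n)
    lhs≃ ls ls≤n = toℚᵘ-+-frac (sumPre≃ [] ls≤n dPre*d≃) (toℚᵘ-/ (countPre S n []) (N ^ n))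

    mid≃ : (ls : List ℕ) → All (ℕ._≤ n) ls → toℚᵘ (midSum S ls ℚ.+ dPre S n ls) ≃ frac (scaledMid n ls) (N ^ n)
    mid≃ ls ls≤n = toℚᵘ-+-frac (sumPre≃ [] ls≤n dPre≃) (toℚᵘ-/ (countPre S n ls) (N ^ n))

    1≃ : toℚᵘ 1ℚ ≃ frac (N ^ n) (N ^ n)
    1≃ = ≃-trans (toℚᵘ-/ 1 1) (frac-cong 1 (N ^ n) 1 (N ^ n) (ℕ.*-comm 1 (N ^ n)))

open import Defs
open import Data.Nat using (ℕ; _<_)
open import Data.List using (List; []; _∷_)
open import Data.List.Relation.Unary.All using (All)
open import Data.List.Relation.Unary.Linked using (Linked)
open import Data.Product using (_×_)
open import Data.Rational using (ℚ; _≤_; _+_; 1ℚ)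
open import Relation.Binary.PropositionalEquality using (_≢_)

open import Data.Nat.Properties using (<⇒≤; <-trans)
import Data.List.Relation.Unary.All as All
open import Data.List.Relation.Unary.Linked.Properties using (Linked⇒AllPairs)
open import Data.Product using (_,_)
open Counting using (module Densities)
open CommonDenominator using (≤-by-numerators; module OverCommonDenominator)

proposition3p1 : (a : ℕ) (S : Subset a) → ProductFree S →
    (n : ℕ) (ls : List ℕ) → ls ≢ [] → Linked _<_ ls → All (λ l → 0 < l) ls → All (λ l → l < n) ls →
    (lhsSum S n ls + d S n ≤ midSum S ls + dPre S n ls) × (midSum S ls + dPre S n ls ≤ 1ℚ)
proposition3p1 a S productFree n ls _ linked pos ls<n =
  ≤-by-numerators (lhs≃ ls ls≤n) (mid≃ ls ls≤n) (scaledLhs≤scaledMid productFree n ls sorted pos ls<n) ,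
  ≤-by-numerators (mid≃ ls ls≤n) 1≃ (scaledMid≤N^n n ls sorted ls≤n)
  where
  open Densities S
  open OverCommonDenominator S n
  ls≤n = All.map <⇒≤ ls<n
  sorted = Linked⇒AllPairs <-trans linked
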